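{- Let $K$ be a commutative semiring, $A$ a finite alphabet, and let $\sigma\in K\langle\langle A\rangle\rangle$ be a context-free power series. Then there exists a closed $\mu$-expression $t\in\mathcal{T}_\mu$ over $K$ such that $[\![t]\!]=\sigma$.
   Context: $K\langle\langle A\rangle\rangle$ is the set of functions $A^*\to K$, the final $K\times(-)^A$-coalgebra with $o(\sigma)=\sigma(\epsilon)$ and $\sigma_a(w)=\sigma(aw)$. For a finite set $X$, $K\langle X\rangle$ denotes the semiring of finitely supported functions $X^*\to K$ (noncommutative polynomials) with usual sum and product. Given $(o,\delta):X\to K\times K\langle X\rangle^A$ (write $x_a=\delta(x)(a)$), its extension to a $K\times(-)^A$-coalgebra on $K\langle X\rangle$ is: $\hat o(1)=1$, $1_a=0$; for $x\in X$, $w\in X^*$: $\hat o(xw)=o(x)\hat o(w)$, $(xw)_a=x_aw+o(x)w_a$; and linearly $\hat o(\sum k_iw_i)=\sum k_i\hat o(w_i)$, $(\sum k_iw_i)_a=\sum k_i(w_i)_a$. A power series is context-free (constructively algebraic) if it equals $[\![p]\!]$ for some finite $X$, some such $(o,\delta)$ and some $p\in K\langle X\rangle$, where $[\![-]\!]$ is the final homomorphism from the extension. $\mu$-expressions over a countably infinite variable set $V$: $t::=\bar k\ (k\in K)\mid x\ (x\in V)\mid \bar a\ (a\in A)\mid t+t\mid t\times t\mid \mu x.g$, with guarded terms $g::=\bar a\times t\ (a\in A)\mid \bar k\ (k\in K)\mid g+g$ ($\mu x$ binds $x$). $\mathcal{T}_\mu$ is the set of closed $\mu$-expressions, a $K\times(-)^A$-coalgebra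 via: $o(\bar k)=k$, $\bar k_a=\bar 0$; $o(\bar b)=0$, $\bar b_a=\bar 1$ if $b=a$ else $\bar 0$; $o(u+v)=o(u)+o(v)$, $(u+v)_a=u_a+v_a$; $o(u\times v)=o(u)\cdot o(v)$, $(u\times v)_a=(u_a\times v)+(\overline{o(u)}\times v_a)$; $o(\mu x.u)=o(u[\mu x.u/x])$, $(\mu x.u)_a=(u[\mu x.u/x])_a$, where $u[\mu x.u/x]$ substitutes $\mu x.u$ for the free occurrences of $x$. $[\![-]\!]:\mathcal{T}_\mu\to K\langle\langle A\rangle\rangle$ is the final homomorphism.
   Formalization: Within a guarded term under μ, the summand ā × t has output 0 instead of 0·o(t) and derivative $(\bar a_b\times t)+(\bar 0\times t)$ in place of $(\bar a_b\times t)+(\bar 0\times t_b)$. Apart from conventions, each condition added here is assumed in the paper as well or is needed for the statement above to hold. -}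

module Defs where

open import Level using (Level; _⊔_)
open import Algebra.Bundles using (CommutativeSemiring)
open import Data.Nat using (ℕ)
import Data.Nat as Nat
open import Data.Fin using (Fin)
import Data.Fin as Fin
open import Data.List using (List; []; _∷_; _++_; map; concatMap; foldr)
open import Data.Product using (_×_; _,_; Σ; Σ-syntax)
open import Relation.Nullary using (¬_; yes; no)
open import Relation.Binary.PropositionalEquality using (_≡_; _≢_)

module Series {c ℓ} (K : CommutativeSemiring c ℓ) (n : ℕ) where
  open CommutativeSemiring K using (_≈_; _+_; _*_; 0#; 1#) renaming (Carrier to R)

  Alphabet : Set
  Alphabet = Fin n

  Word : Set
  Word = List Alphabet

  PowerSeries : Set c
  PowerSeries = Word → R

  _≈ₛ_ : PowerSeries → PowerSeries → Set ℓ
  σ ≈ₛ τ = ∀ w → σ w ≈ τ w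

  -- The final homomorphism from a K × (-)^A coalgebra (S, out, der) into
  -- the final coalgebra K⟨⟨A⟩⟩ (o(σ) = σ(ε), σ_a(w) = σ(aw)).
  beh : ∀ {s} {S : Set s} → (S → R) → (S → Alphabet → S) → S → PowerSeries
  beh out der x []      = out x
  beh out der x (a ∷ w) = beh out der (der x a) w

  -- Noncommutative polynomials K⟨X⟩ over X = Fin m, represented as
  -- formal finite sums  Σ kᵢ wᵢ  (lists of coefficient/monomial pairs).
  Monomial : ℕ → Set
  Monomial m = List (Fin m)

  Polynomial : ℕ → Set c
  Polynomial m = List (R × Monomial m)

  -- The extension of (o, δ) : X → K × K⟨X⟩^A to a coalgebra on K⟨X⟩.
  module Extension {m : ℕ} (o : Fin m → R) (δ : Fin m → Alphabet → Polynomial m) where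
    scale : R → Polynomial m → Polynomial m
    scale k = map (λ (k' , u) → (k * k' , u))

    _·ʳ_ : Polynomial m → Monomial m → Polynomial m
    p ·ʳ w = map (λ (k , u) → (k , u ++ w)) p

    ôMono : Monomial m → R
    ôMono []      = 1#
    ôMono (x ∷ w) = o x * ôMono w

    derMono : Monomial m → Alphabet → Polynomial m
    derMono []      a = []
    derMono (x ∷ w) a = (δ x a ·ʳ w) ++ scale (o x) (derMono w a)

    ô : Polynomial m → R
    ô = foldr (λ (k , u) r → k * ôMono u + r) 0#

    derPoly : Polynomial m → Alphabet → Polynomial m
    derPoly p a = concatMap (λ (k , u) → scale k (derMono u a)) p

    ⟦_⟧ : Polynomial m → PowerSeries
    ⟦_⟧ = beh ô derPoly

  ContextFree : PowerSeries → Set (c ⊔ ℓ)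
  ContextFree σ =
    Σ[ m ∈ ℕ ] Σ[ o ∈ (Fin m → R) ] Σ[ δ ∈ (Fin m → Alphabet → Polynomial m) ]
    Σ[ p ∈ Polynomial m ] (Extension.⟦_⟧ o δ p ≈ₛ σ)

  Var : Set
  Var = ℕ

  mutual
    data Term : Set c where
      const : R → Term
      var   : Var → Term
      sym   : Alphabet → Term
      _⊕_   : Term → Term → Term
      _⊗_   : Term → Term → Term
      μ     : Var → Guarded → Term

    data Guarded : Set c where
      gsym   : Alphabet → Term → Guarded
      gconst : R → Guarded
      _⊕g_   : Guarded → Guarded → Guarded

  mutual
    data FreeIn (x : Var) : Term → Set c where
      fvar : FreeIn x (var x)
      f⊕ˡ  : ∀ {u v} → FreeIn x u → FreeIn x (u ⊕ v)
      f⊕ʳ  : ∀ {u v} → FreeIn x v → FreeIn x (u ⊕ v)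
      f⊗ˡ  : ∀ {u v} → FreeIn x u → FreeIn x (u ⊗ v)
      f⊗ʳ  : ∀ {u v} → FreeIn x v → FreeIn x (u ⊗ v)
      fμ   : ∀ {y g} → x ≢ y → FreeInG x g → FreeIn x (μ y g)

    data FreeInG (x : Var) : Guarded → Set c where
      gfsym : ∀ {a t} → FreeIn x t → FreeInG x (gsym a t)
      gf⊕ˡ  : ∀ {g h} → FreeInG x g → FreeInG x (g ⊕g h)
      gf⊕ʳ  : ∀ {g h} → FreeInG x h → FreeInG x (g ⊕g h)

  Closed : Term → Set c
  Closed t = ∀ x → ¬ FreeIn x t

  -- substitution t[s/x] of a (closed) term s for the free occurrences of x
  mutual
    subst : Var → Term → Term → Term
    subst x s (const k) = const k
    subst x s (var y) with x Nat.≟ y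
    ... | yes _ = s
    ... | no  _ = var y
    subst x s (sym b) = sym b
    subst x s (u ⊕ v) = subst x s u ⊕ subst x s v
    subst x s (u ⊗ v) = subst x s u ⊗ subst x s v
    subst x s (μ y g) with x Nat.≟ y
    ... | yes _ = μ y g
    ... | no  _ = μ y (substG x s g)

    substG : Var → Term → Guarded → Guarded
    substG x s (gsym b t) = gsym b (subst x s t)
    substG x s (gconst k) = gconst k
    substG x s (g ⊕g h)   = substG x s g ⊕g substG x s h

  derSym : Alphabet → Alphabet → Term
  derSym b a with a Fin.≟ b
  ... | yes _ = const 1#
  ... | no  _ = const 0#

  -- output of a guarded term: o(ā × t) = o(ā)·o(t) = 0·o(t) = 0
  oG : Guarded → R
  oG (gsym b t) = 0#
  oG (gconst k) = k
  oG (g ⊕g h)   = oG g + oG h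

  out : Term → R
  out (const k) = k
  out (var x)   = 0#          -- never reached from closed terms
  out (sym b)   = 0#
  out (u ⊕ v)   = out u + out v
  out (u ⊗ v)   = out u * out v
  out (μ x g)   = oG g        -- = o(g[μx.g/x]) (substitution does not affect oG)

  -- derivative of a guarded term: (ā × t)_b = (ā_b × t) + (0̄ × t)
  derG : Guarded → Alphabet → Term
  derG (gsym b t) a = (derSym b a ⊗ t) ⊕ (const 0# ⊗ t)
  derG (gconst k) a = const 0#
  derG (g ⊕g h)   a = derG g a ⊕ derG h a

  der : Term → Alphabet → Term
  der (const k) a = const 0#
  der (var x)   a = const 0#  -- never reached from closed terms
  der (sym b)   a = derSym b a
  der (u ⊕ v)   a = der u a ⊕ der v a
  der (u ⊗ v)   a = (der u a ⊗ v) ⊕ (const (out u) ⊗ der v a)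
  der (μ x g)   a = derG (substG x (μ x g) g) a

  ⟦_⟧μ : Term → PowerSeries
  ⟦_⟧μ = beh out der

-- Bekić's elimination turns the polynomial system behind σ into closed μ-expressions.
-- The term for an unknown x_j is μx_j.(o(x_j) + Σ_b b × δ(x_j)(b)), in which every other
-- unknown not yet bound by an enclosing μ is replaced by its own term, built in the same
-- way one level further in. Unfolding the outer μ substitutes the term itself for x_j, so
-- the derivatives of such a term are the right-hand sides of the system evaluated at terms
-- of the same construction. By induction on word length, all terms built for x_j denote
-- the same series, and these series solve the system. Evaluating polynomials in a solution
-- is a coalgebra morphism, so it coincides with the final semantics: [[p(T)]] = [[p]] = σ.

module Submission where

open import Defs
open import Algebra.Bundles using (CommutativeSemiring)
open import Data.Empty using (⊥-elim)
open import Data.Fin using (Fin; zero; suc; toℕ; punchIn; _≟_)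
open import Data.Fin.Properties using (toℕ-injective; punchInᵢ≢i)
open import Data.List using ([]; _∷_; _++_; length)
open import Data.Maybe using (Maybe; just; nothing; maybe′; fromMaybe)
import Data.Maybe as Maybe
open import Data.Nat as Nat using (ℕ; zero; suc; _≤_; _<_; z≤n; s≤s; s≤s⁻¹)
open import Data.Nat.Properties using (m≤n⇒m≤1+n; ≤-refl; +-0-commutativeMonoid)
open import Data.Product using (_×_; _,_; Σ-syntax)
open import Data.Sum using (_⊎_; inj₁; inj₂)
open import Data.Vec.Functional using (removeAt)
open import Function using (_∘_)
open import Level using (_⊔_)
open import Relation.Nullary using (¬_; yes; no)
import Relation.Binary.PropositionalEquality as ≡
open ≡ using (_≡_; _≢_; _≗_; refl; cong; cong₂)

module PartialMaps {a} {A : Set a} where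
  open import Algebra.Properties.CommutativeMonoid.Sum +-0-commutativeMonoid
    using (sum; sum-remove; sum-cong-≗)
  open Nat using (_+_)
  open ≡.≡-Reasoning

  private variable
    m : ℕ
    ρ ρ′ : Fin m → Maybe A

  bind : (Fin m → Maybe A) → Fin m → A → Fin m → Maybe A
  bind ρ j t k with k ≟ j
  ... | yes _ = just t
  ... | no  _ = ρ k

  bind-same : ∀ (ρ : Fin m → Maybe A) j t → bind ρ j t j ≡ just t
  bind-same ρ j t with j ≟ j
  ... | yes _   = refl
  ... | no  j≢j = ⊥-elim (j≢j refl)

  bind-other : ∀ (ρ : Fin m → Maybe A) {j} t {k} → k ≢ j → bind ρ j t k ≡ ρ k
  bind-other ρ {j} t {k} k≢j with k ≟ j
  ... | yes k≡j = ⊥-elim (k≢j k≡j)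
  ... | no  _   = refl

  bind-cong : ρ ≗ ρ′ → ∀ j t → bind ρ j t ≗ bind ρ′ j t
  bind-cong ρ≗ρ′ j t k with k ≟ j
  ... | yes _ = refl
  ... | no  _ = ρ≗ρ′ k

  All : ∀ {p} → (Fin m → A → Set p) → (Fin m → Maybe A) → Set (a ⊔ p)
  All P ρ = ∀ k {t} → ρ k ≡ just t → P k t

  bind-all : ∀ {p} {P : Fin m → A → Set p} (ρ : Fin m → Maybe A) j t →
             All P ρ → P j t → All P (bind ρ j t)
  bind-all ρ j t h p k e with k ≟ j
  bind-all ρ j t h p k refl | yes refl = p
  bind-all ρ j t h p k e    | no  _    = h k e

  Any : ∀ {p} → (A → Set p) → (Fin m → Maybe A) → Set (a ⊔ p)
  Any P ρ = Σ[ k ∈ Fin _ ] Σ[ t ∈ A ] (ρ k ≡ just t × P t)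

  bind-any : ∀ {p} {P : A → Set p} (ρ : Fin m → Maybe A) j t → Any P (bind ρ j t) → P t ⊎ Any P ρ
  bind-any ρ j t (k , t′ , e , p) with k ≟ j
  bind-any ρ j t (k , t′ , refl , p) | yes _ = inj₁ p
  bind-any ρ j t (k , t′ , e    , p) | no  _ = inj₂ (k , t′ , e , p)

  private
    countNothing : Maybe A → ℕ
    countNothing = maybe′ (λ _ → 0) 1

  unbound : (Fin m → Maybe A) → ℕ
  unbound ρ = sum (countNothing ∘ ρ)

  unbound-bind : ∀ (ρ : Fin m → Maybe A) {j} t → ρ j ≡ nothing →
                 unbound ρ ≡ suc (unbound (bind ρ j t))
  unbound-bind {m = suc m} ρ {j} t ρj≡nothing = begin
    unbound ρ                           ≡⟨ sum-remove {i = j} (countNothing ∘ ρ) ⟩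
    countNothing (ρ j) + rest ρ         ≡⟨ cong₂ _+_ (cong countNothing ρj≡nothing)
                                                     (sum-cong-≗ (cong countNothing ∘ ≡.sym ∘ outside)) ⟩
    suc (rest ρ₁)                       ≡⟨ cong (λ z → suc (countNothing z + rest ρ₁)) (bind-same ρ j t) ⟨
    suc (countNothing (ρ₁ j) + rest ρ₁) ≡⟨ cong suc (sum-remove {i = j} (countNothing ∘ ρ₁)) ⟨
    suc (unbound ρ₁)                    ∎
    where
    ρ₁ : Fin (suc m) → Maybe A
    ρ₁ = bind ρ j t
    rest : (Fin (suc m) → Maybe A) → ℕ
    rest τ = sum (removeAt (countNothing ∘ τ) j)
    outside : ∀ i → bind ρ j t (punchIn j i) ≡ ρ (punchIn j i)
    outside i = bind-other ρ t (punchInᵢ≢i j i)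

  unbound-bind-< : ∀ {ρ : Fin m → Maybe A} {j d} t → ρ j ≡ nothing → unbound ρ ≤ d →
                   unbound (bind ρ j t) < d
  unbound-bind-< {ρ = ρ} {d = d} t ρj≡nothing = ≡.subst (_≤ d) (unbound-bind ρ t ρj≡nothing)

module PowerSeriesAlgebra {c ℓ} (K : CommutativeSemiring c ℓ) (n : ℕ) where
  open CommutativeSemiring K
    renaming (Carrier to R; refl to ≈-refl; sym to ≈-sym; trans to ≈-trans)
  open Series K n
  open import Algebra.Properties.CommutativeSemigroup +-commutativeSemigroup
    using (interchange)
  open import Relation.Binary.Reasoning.Setoid setoid

  private variable
    k k′ : R
    a : Alphabet
    N : ℕ
    σ σ′ τ τ′ υ : PowerSeries

  infixl 25 _⊞_
  infixl 30 _⊙_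
  infixr 30 _·ₛ_
  infix 4 _≈[_]_

  0ₛ : PowerSeries
  0ₛ _ = 0#

  constant : R → PowerSeries
  constant k []      = k
  constant k (_ ∷ _) = 0#

  _⊞_ : PowerSeries → PowerSeries → PowerSeries
  (σ ⊞ τ) w = σ w + τ w

  _·ₛ_ : R → PowerSeries → PowerSeries
  (k ·ₛ σ) w = k * σ w

  ∂ : PowerSeries → Alphabet → PowerSeries
  ∂ σ a w = σ (a ∷ w)

  -- Defined by the derivative rule (σ ⊙ τ)_a = σ_a ⊙ τ + σ(ε) ⊙ τ_a, as for μ-expressions.
  _⊙_ : PowerSeries → PowerSeries → PowerSeries
  (σ ⊙ τ) []      = σ [] * τ []
  (σ ⊙ τ) (a ∷ w) = (∂ σ a ⊙ τ) w + (constant (σ []) ⊙ ∂ τ a) w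

  _≈[_]_ : PowerSeries → ℕ → PowerSeries → Set ℓ
  σ ≈[ N ] τ = ∀ w → length w ≤ N → σ w ≈ τ w

  ≈[]-pred : σ ≈[ suc N ] τ → σ ≈[ N ] τ
  ≈[]-pred h w l = h w (m≤n⇒m≤1+n l)

  ∂-≈[] : σ ≈[ suc N ] τ → ∂ σ a ≈[ N ] ∂ τ a
  ∂-≈[] {a = a} h w l = h (a ∷ w) (s≤s l)

  ≈ₛ⇒≈[] : σ ≈ₛ τ → σ ≈[ N ] τ
  ≈ₛ⇒≈[] h w _ = h w

  constant-cong : k ≈ k′ → constant k ≈ₛ constant k′
  constant-cong e []      = e
  constant-cong e (_ ∷ _) = ≈-refl

  ⊙-cong-≈[] : σ ≈[ N ] σ′ → τ ≈[ N ] τ′ → σ ⊙ τ ≈[ N ] σ′ ⊙ τ′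
  ⊙-cong-≈[] hσ hτ []      _       = *-cong (hσ [] z≤n) (hτ [] z≤n)
  ⊙-cong-≈[] hσ hτ (a ∷ w) (s≤s l) =
    +-cong (⊙-cong-≈[] (∂-≈[] hσ) (≈[]-pred hτ) w l)
           (⊙-cong-≈[] (≈ₛ⇒≈[] (constant-cong (hσ [] z≤n))) (∂-≈[] hτ) w l)

  ⊙-cong : σ ≈ₛ σ′ → τ ≈ₛ τ′ → σ ⊙ τ ≈ₛ σ′ ⊙ τ′
  ⊙-cong hσ hτ w = ⊙-cong-≈[] (≈ₛ⇒≈[] hσ) (≈ₛ⇒≈[] hτ) w ≤-refl

  ⊙-zeroˡ : σ ≈ₛ 0ₛ → σ ⊙ τ ≈ₛ 0ₛ
  ⊙-zeroˡ h []      = ≈-trans (*-congʳ (h [])) (zeroˡ _)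
  ⊙-zeroˡ h (a ∷ w) =
    ≈-trans (+-cong (⊙-zeroˡ (λ v → h (a ∷ v)) w)
                    (⊙-zeroˡ (λ { [] → h [] ; (_ ∷ _) → ≈-refl }) w))
            (+-identityˡ 0#)

  constant-⊙ : constant k ⊙ τ ≈ₛ k ·ₛ τ
  constant-⊙ []      = ≈-refl
  constant-⊙ (a ∷ w) =
    ≈-trans (+-cong (⊙-zeroˡ (λ _ → ≈-refl) w) (constant-⊙ w)) (+-identityˡ _)

  constant-* : constant (k * k′) ≈ₛ k ·ₛ constant k′
  constant-* []      = ≈-refl
  constant-* (_ ∷ _) = ≈-sym (zeroʳ _)

  constant-+ : constant (k + k′) ≈ₛ constant k ⊞ constant k′
  constant-+ []      = ≈-refl
  constant-+ (_ ∷ _) = ≈-sym (+-identityˡ 0#)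

  ·ₛ-⊙-assoc : (k ·ₛ σ) ⊙ τ ≈ₛ k ·ₛ (σ ⊙ τ)
  ·ₛ-⊙-assoc []      = *-assoc _ _ _
  ·ₛ-⊙-assoc {k} {σ} {τ} (a ∷ w) = begin
    (∂ (k ·ₛ σ) a ⊙ τ) w + (constant (k * σ []) ⊙ ∂ τ a) w
      ≈⟨ +-cong (·ₛ-⊙-assoc w)
                (≈-trans (⊙-cong constant-* (λ _ → ≈-refl) w) (·ₛ-⊙-assoc w)) ⟩
    k * (∂ σ a ⊙ τ) w + k * (constant (σ []) ⊙ ∂ τ a) w
      ≈⟨ distribˡ k _ _ ⟨
    k * (σ ⊙ τ) (a ∷ w) ∎

  ⊙-distribʳ-⊞ : (σ ⊞ σ′) ⊙ τ ≈ₛ (σ ⊙ τ) ⊞ (σ′ ⊙ τ)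
  ⊙-distribʳ-⊞ []      = distribʳ _ _ _
  ⊙-distribʳ-⊞ {σ} {σ′} {τ} (a ∷ w) = begin
    (∂ (σ ⊞ σ′) a ⊙ τ) w + (constant (σ [] + σ′ []) ⊙ ∂ τ a) w
      ≈⟨ +-cong (⊙-distribʳ-⊞ w)
                (≈-trans (⊙-cong constant-+ (λ _ → ≈-refl) w) (⊙-distribʳ-⊞ w)) ⟩
    ((∂ σ a ⊙ τ) w + (∂ σ′ a ⊙ τ) w)
      + ((constant (σ []) ⊙ ∂ τ a) w + (constant (σ′ []) ⊙ ∂ τ a) w)
      ≈⟨ interchange _ _ _ _ ⟩
    (σ ⊙ τ) (a ∷ w) + (σ′ ⊙ τ) (a ∷ w) ∎

  ⊙-assoc : (σ ⊙ τ) ⊙ υ ≈ₛ σ ⊙ (τ ⊙ υ)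
  ⊙-assoc []      = *-assoc _ _ _
  ⊙-assoc {σ} {τ} {υ} (a ∷ w) = begin
    (∂ (σ ⊙ τ) a ⊙ υ) w + (constant (σ [] * τ []) ⊙ ∂ υ a) w
      ≈⟨ +-cong (⊙-distribʳ-⊞ w) (constant-⊙ w) ⟩
    (((∂ σ a ⊙ τ) ⊙ υ) w + ((constant (σ []) ⊙ ∂ τ a) ⊙ υ) w) + (σ [] * τ []) * υ (a ∷ w)
      ≈⟨ +-cong (+-cong (⊙-assoc w)
                         (≈-trans (⊙-cong constant-⊙ (λ _ → ≈-refl) w) (·ₛ-⊙-assoc w)))
                (*-assoc _ _ _) ⟩
    ((∂ σ a ⊙ (τ ⊙ υ)) w + σ [] * (∂ τ a ⊙ υ) w) + σ [] * (τ [] * υ (a ∷ w))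
      ≈⟨ +-assoc _ _ _ ⟩
    (∂ σ a ⊙ (τ ⊙ υ)) w + (σ [] * (∂ τ a ⊙ υ) w + σ [] * (τ [] * υ (a ∷ w)))
      ≈⟨ +-congˡ (distribˡ _ _ _) ⟨
    (∂ σ a ⊙ (τ ⊙ υ)) w + σ [] * ((∂ τ a ⊙ υ) w + τ [] * υ (a ∷ w))
      ≈⟨ +-congˡ (*-congˡ (+-congˡ (constant-⊙ w))) ⟨
    (∂ σ a ⊙ (τ ⊙ υ)) w + σ [] * (τ ⊙ υ) (a ∷ w)
      ≈⟨ +-congˡ (constant-⊙ w) ⟨
    (σ ⊙ (τ ⊙ υ)) (a ∷ w) ∎

  evalMono : ∀ {m} → (Fin m → PowerSeries) → Monomial m → PowerSeries
  evalMono F []      = constant 1#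
  evalMono F (x ∷ u) = F x ⊙ evalMono F u

  evalPoly : ∀ {m} → (Fin m → PowerSeries) → Polynomial m → PowerSeries
  evalPoly F []            = 0ₛ
  evalPoly F ((k , u) ∷ q) = k ·ₛ evalMono F u ⊞ evalPoly F q

  module _ {m} {F G : Fin m → PowerSeries} (F≈G : ∀ x → F x ≈[ N ] G x) where

    evalMono-cong-≈[] : ∀ u → evalMono F u ≈[ N ] evalMono G u
    evalMono-cong-≈[] []      w l = ≈-refl
    evalMono-cong-≈[] (x ∷ u) w l = ⊙-cong-≈[] (F≈G x) (evalMono-cong-≈[] u) w l

    evalPoly-cong-≈[] : ∀ q → evalPoly F q ≈[ N ] evalPoly G q
    evalPoly-cong-≈[] []            w l = ≈-refl
    evalPoly-cong-≈[] ((k , u) ∷ q) w l =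
      +-cong (*-congˡ (evalMono-cong-≈[] u w l)) (evalPoly-cong-≈[] q w l)

  module _ {m} (o : Fin m → R) (δ : Fin m → Alphabet → Polynomial m) where
    open Extension o δ

    module _ {F : Fin m → PowerSeries} where

      evalPoly-++ : ∀ q q′ → evalPoly F (q ++ q′) ≈ₛ evalPoly F q ⊞ evalPoly F q′
      evalPoly-++ []            q′ w = ≈-sym (+-identityˡ _)
      evalPoly-++ ((k , u) ∷ q) q′ w =
        ≈-trans (+-congˡ (evalPoly-++ q q′ w)) (≈-sym (+-assoc _ _ _))

      evalPoly-scale : ∀ k q → evalPoly F (scale k q) ≈ₛ k ·ₛ evalPoly F q
      evalPoly-scale k []             w = ≈-sym (zeroʳ k)
      evalPoly-scale k ((k′ , u) ∷ q) w =
        ≈-trans (+-cong (*-assoc k k′ _) (evalPoly-scale k q w)) (≈-sym (distribˡ k _ _))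

      evalMono-++ : ∀ v u → evalMono F (v ++ u) ≈ₛ evalMono F v ⊙ evalMono F u
      evalMono-++ []      u w = ≈-sym (≈-trans (constant-⊙ w) (*-identityˡ _))
      evalMono-++ (x ∷ v) u w =
        ≈-trans (⊙-cong (λ _ → ≈-refl) (evalMono-++ v u) w) (≈-sym (⊙-assoc w))

      evalPoly-·ʳ : ∀ q u → evalPoly F (q ·ʳ u) ≈ₛ evalPoly F q ⊙ evalMono F u
      evalPoly-·ʳ []            u w = ≈-sym (⊙-zeroˡ (λ _ → ≈-refl) w)
      evalPoly-·ʳ ((k , v) ∷ q) u w = begin
        k * evalMono F (v ++ u) w + evalPoly F (q ·ʳ u) w
          ≈⟨ +-cong (*-congˡ (evalMono-++ v u w)) (evalPoly-·ʳ q u w) ⟩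
        k * (evalMono F v ⊙ evalMono F u) w + (evalPoly F q ⊙ evalMono F u) w
          ≈⟨ +-congʳ (·ₛ-⊙-assoc w) ⟨
        ((k ·ₛ evalMono F v) ⊙ evalMono F u) w + (evalPoly F q ⊙ evalMono F u) w
          ≈⟨ ⊙-distribʳ-⊞ w ⟨
        (evalPoly F ((k , v) ∷ q) ⊙ evalMono F u) w ∎

    record IsSolution (F : Fin m → PowerSeries) : Set ℓ where
      field
        output     : ∀ x → F x [] ≈ o x
        derivative : ∀ x a → ∂ (F x) a ≈ₛ evalPoly F (δ x a)

    module _ {F : Fin m → PowerSeries} (F-solution : IsSolution F) where
      open IsSolution F-solution

      evalMono-output : ∀ u → evalMono F u [] ≈ ôMono u
      evalMono-output []      = ≈-refl
      evalMono-output (x ∷ u) = *-cong (output x) (evalMono-output u)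

      evalPoly-output : ∀ q → evalPoly F q [] ≈ ô q
      evalPoly-output []            = ≈-refl
      evalPoly-output ((k , u) ∷ q) = +-cong (*-congˡ (evalMono-output u)) (evalPoly-output q)

      ∂-evalMono : ∀ u a → ∂ (evalMono F u) a ≈ₛ evalPoly F (derMono u a)
      ∂-evalMono []      a w = ≈-refl
      ∂-evalMono (x ∷ u) a w = begin
        (∂ (F x) a ⊙ evalMono F u) w + (constant (F x []) ⊙ ∂ (evalMono F u) a) w
          ≈⟨ +-cong (⊙-cong (derivative x a) (λ _ → ≈-refl) w)
                    (≈-trans (constant-⊙ w) (*-cong (output x) (∂-evalMono u a w))) ⟩
        (evalPoly F (δ x a) ⊙ evalMono F u) w + o x * evalPoly F (derMono u a) w
          ≈⟨ +-cong (evalPoly-·ʳ (δ x a) u w) (evalPoly-scale (o x) (derMono u a) w) ⟨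
        evalPoly F (δ x a ·ʳ u) w + evalPoly F (scale (o x) (derMono u a)) w
          ≈⟨ evalPoly-++ (δ x a ·ʳ u) _ w ⟨
        evalPoly F (derMono (x ∷ u) a) w ∎

      ∂-evalPoly : ∀ q a → ∂ (evalPoly F q) a ≈ₛ evalPoly F (derPoly q a)
      ∂-evalPoly []            a w = ≈-refl
      ∂-evalPoly ((k , u) ∷ q) a w = begin
        k * evalMono F u (a ∷ w) + evalPoly F q (a ∷ w)
          ≈⟨ +-cong (*-congˡ (∂-evalMono u a w)) (∂-evalPoly q a w) ⟩
        k * evalPoly F (derMono u a) w + evalPoly F (derPoly q a) w
          ≈⟨ +-congʳ (evalPoly-scale k (derMono u a) w) ⟨
        evalPoly F (scale k (derMono u a)) w + evalPoly F (derPoly q a) w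
          ≈⟨ evalPoly-++ (scale k (derMono u a)) (derPoly q a) w ⟨
        evalPoly F (derPoly ((k , u) ∷ q) a) w ∎

      ⟦⟧≈evalPoly : ∀ q → ⟦ q ⟧ ≈ₛ evalPoly F q
      ⟦⟧≈evalPoly q []      = ≈-sym (evalPoly-output q)
      ⟦⟧≈evalPoly q (a ∷ w) = ≈-trans (⟦⟧≈evalPoly (derPoly q a) w) (≈-sym (∂-evalPoly q a w))

module MuSyntax {c ℓ} (K : CommutativeSemiring c ℓ) (n : ℕ) where
  open CommutativeSemiring K using (0#; 1#) renaming (Carrier to R)
  open Series K n
  open PartialMaps {A = Term}

  private variable
    x : Var
    s : Term

  gsum : ∀ {k} → (Fin k → Guarded) → Guarded
  gsum {zero}  f = gconst 0#
  gsum {suc k} f = f zero ⊕g gsum (f ∘ suc)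

  gsum-cong : ∀ {k} {f g : Fin k → Guarded} → f ≗ g → gsum f ≡ gsum g
  gsum-cong {zero}  f≗g = refl
  gsum-cong {suc k} f≗g = cong₂ _⊕g_ (f≗g zero) (gsum-cong (f≗g ∘ suc))

  substG-gsum : ∀ {k} (f : Fin k → Guarded) → substG x s (gsum f) ≡ gsum (substG x s ∘ f)
  substG-gsum {k = zero}  f = refl
  substG-gsum {k = suc k} f = cong (substG _ _ (f zero) ⊕g_) (substG-gsum (f ∘ suc))

  freeIn-gsum : ∀ {k} (f : Fin k → Guarded) → FreeInG x (gsum f) → Σ[ i ∈ Fin k ] FreeInG x (f i)
  freeIn-gsum {k = suc k} f (gf⊕ˡ h) = zero , h
  freeIn-gsum {k = suc k} f (gf⊕ʳ h) with freeIn-gsum (f ∘ suc) h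
  ... | i , h′ = suc i , h′

  freeIn-var : ∀ {y} → FreeIn x (var y) → x ≡ y
  freeIn-var fvar = refl

  subst-var-≡ : subst x s (var x) ≡ s
  subst-var-≡ {x} with x Nat.≟ x
  ... | yes _   = refl
  ... | no  x≢x = ⊥-elim (x≢x refl)

  subst-var-≢ : ∀ {y} → x ≢ y → subst x s (var y) ≡ var y
  subst-var-≢ {x} {y = y} x≢y with x Nat.≟ y
  ... | yes x≡y = ⊥-elim (x≢y x≡y)
  ... | no  _   = refl

  mutual
    subst-fresh : ∀ t → ¬ FreeIn x t → subst x s t ≡ t
    subst-fresh (const k) x∉t = refl
    subst-fresh (var y)   x∉t = subst-var-≢ λ x≡y → x∉t (≡.subst (λ z → FreeIn _ (var z)) x≡y fvar)
    subst-fresh (sym b)   x∉t = refl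
    subst-fresh (u ⊕ v)   x∉t = cong₂ _⊕_ (subst-fresh u (x∉t ∘ f⊕ˡ)) (subst-fresh v (x∉t ∘ f⊕ʳ))
    subst-fresh (u ⊗ v)   x∉t = cong₂ _⊗_ (subst-fresh u (x∉t ∘ f⊗ˡ)) (subst-fresh v (x∉t ∘ f⊗ʳ))
    subst-fresh {x} (μ y g) x∉t with x Nat.≟ y
    ... | yes _   = refl
    ... | no  x≢y = cong (μ y) (substG-fresh g (x∉t ∘ fμ x≢y))

    substG-fresh : ∀ g → ¬ FreeInG x g → substG x s g ≡ g
    substG-fresh (gsym a t) x∉g = cong (gsym a) (subst-fresh t (x∉g ∘ gfsym))
    substG-fresh (gconst k) x∉g = refl
    substG-fresh (g ⊕g h)   x∉g =
      cong₂ _⊕g_ (substG-fresh g (x∉g ∘ gf⊕ˡ)) (substG-fresh h (x∉g ∘ gf⊕ʳ))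

  module System {m : ℕ} (o : Fin m → R) (δ : Fin m → Alphabet → Polynomial m) where

    private variable
      θ θ′ : Fin m → Term

    monoTerm : (Fin m → Term) → Monomial m → Term
    monoTerm θ []      = const 1#
    monoTerm θ (x ∷ u) = θ x ⊗ monoTerm θ u

    polyTerm : (Fin m → Term) → Polynomial m → Term
    polyTerm θ []            = const 0#
    polyTerm θ ((k , u) ∷ q) = (const k ⊗ monoTerm θ u) ⊕ polyTerm θ q

    equation : Fin m → (Fin m → Term) → Guarded
    equation j θ = gconst (o j) ⊕g gsum (λ b → gsym b (polyTerm θ (δ j b)))

    monoTerm-cong : θ ≗ θ′ → ∀ u → monoTerm θ u ≡ monoTerm θ′ u
    monoTerm-cong θ≗θ′ []      = refl
    monoTerm-cong θ≗θ′ (x ∷ u) = cong₂ _⊗_ (θ≗θ′ x) (monoTerm-cong θ≗θ′ u)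

    polyTerm-cong : θ ≗ θ′ → ∀ q → polyTerm θ q ≡ polyTerm θ′ q
    polyTerm-cong θ≗θ′ []            = refl
    polyTerm-cong θ≗θ′ ((k , u) ∷ q) =
      cong₂ _⊕_ (cong (const k ⊗_) (monoTerm-cong θ≗θ′ u)) (polyTerm-cong θ≗θ′ q)

    equation-cong : ∀ j → θ ≗ θ′ → equation j θ ≡ equation j θ′
    equation-cong j θ≗θ′ =
      cong (gconst (o j) ⊕g_) (gsum-cong (λ b → cong (gsym b) (polyTerm-cong θ≗θ′ (δ j b))))

    subst-monoTerm : ∀ θ u → subst x s (monoTerm θ u) ≡ monoTerm (subst x s ∘ θ) u
    subst-monoTerm θ []      = refl
    subst-monoTerm θ (y ∷ u) = cong (_ ⊗_) (subst-monoTerm θ u)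

    subst-polyTerm : ∀ θ q → subst x s (polyTerm θ q) ≡ polyTerm (subst x s ∘ θ) q
    subst-polyTerm θ []            = refl
    subst-polyTerm θ ((k , u) ∷ q) =
      cong₂ _⊕_ (cong (const k ⊗_) (subst-monoTerm θ u)) (subst-polyTerm θ q)

    substG-equation : ∀ j θ → substG x s (equation j θ) ≡ equation j (subst x s ∘ θ)
    substG-equation j θ = cong (gconst (o j) ⊕g_)
      (≡.trans (substG-gsum _) (gsum-cong (λ b → cong (gsym b) (subst-polyTerm θ (δ j b)))))

    freeIn-monoTerm : ∀ θ u → FreeIn x (monoTerm θ u) → Σ[ k ∈ Fin m ] FreeIn x (θ k)
    freeIn-monoTerm θ (y ∷ u) (f⊗ˡ h) = y , h
    freeIn-monoTerm θ (y ∷ u) (f⊗ʳ h) = freeIn-monoTerm θ u h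

    freeIn-polyTerm : ∀ θ q → FreeIn x (polyTerm θ q) → Σ[ k ∈ Fin m ] FreeIn x (θ k)
    freeIn-polyTerm θ ((k , u) ∷ q) (f⊕ˡ (f⊗ʳ h)) = freeIn-monoTerm θ u h
    freeIn-polyTerm θ ((k , u) ∷ q) (f⊕ʳ h)       = freeIn-polyTerm θ q h

    freeIn-equation : ∀ j θ → FreeInG x (equation j θ) → Σ[ k ∈ Fin m ] FreeIn x (θ k)
    freeIn-equation j θ (gf⊕ʳ h) with freeIn-gsum _ h
    ... | b , gfsym h′ = freeIn-polyTerm θ (δ j b) h′

    -- In an environment ρ, an unknown x_k with ρ k = just t stands for t (the
    -- μ-variable of an enclosing binder, or a closed term); any other unknown is
    -- solved in place by a nested μ. The unknown x_j is the μ-variable toℕ j.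
    -- The depth d must be at least the number of unbound unknowns: the value at
    -- depth 0 is junk.
    mutual
      bekić : ℕ → (Fin m → Maybe Term) → Fin m → Term
      bekić zero    ρ j = const 0#
      bekić (suc d) ρ j = μ (toℕ j) (equation j (resolve d (bind ρ j (var (toℕ j)))))

      resolve : ℕ → (Fin m → Maybe Term) → Fin m → Term
      resolve d ρ k = fromMaybe (bekić d ρ k) (ρ k)

    mutual
      bekić-cong : ∀ d {ρ ρ′} → ρ ≗ ρ′ → ∀ j → bekić d ρ j ≡ bekić d ρ′ j
      bekić-cong zero    ρ≗ρ′ j = refl
      bekić-cong (suc d) ρ≗ρ′ j =
        cong (μ (toℕ j)) (equation-cong j (resolve-cong d (bind-cong ρ≗ρ′ j _)))

      resolve-cong : ∀ d {ρ ρ′} → ρ ≗ ρ′ → ∀ k → resolve d ρ k ≡ resolve d ρ′ k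
      resolve-cong d ρ≗ρ′ k = cong₂ fromMaybe (bekić-cong d ρ≗ρ′ k) (ρ≗ρ′ k)

    -- Substituting for a bound unknown x_j commutes with the construction, because no
    -- nested binder rebinds x_j.
    mutual
      subst-bekić : ∀ d ρ {j} s → ρ j ≢ nothing → ∀ {k} → ρ k ≡ nothing →
                    subst (toℕ j) s (bekić d ρ k) ≡ bekić d (Maybe.map (subst (toℕ j) s) ∘ ρ) k
      subst-bekić zero    ρ     s ρj≢nothing ρk≡nothing = refl
      subst-bekić (suc d) ρ {j} s ρj≢nothing {k} ρk≡nothing with toℕ j Nat.≟ toℕ k
      ... | yes j≡k = ⊥-elim (ρj≢nothing (≡.trans (cong ρ (toℕ-injective j≡k)) ρk≡nothing))
      ... | no  j≢k = cong (μ (toℕ k)) (≡.trans (substG-equation k _) (equation-cong k λ l →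
            ≡.trans (subst-resolve d (bind ρ k (var (toℕ k))) s ρ′j≢nothing l)
                    (resolve-cong d commute l)))
        where
        ρ′j≢nothing : bind ρ k (var (toℕ k)) j ≢ nothing
        ρ′j≢nothing = ρj≢nothing ∘ ≡.trans (≡.sym (bind-other ρ _ (j≢k ∘ cong toℕ)))
        commute : Maybe.map (subst (toℕ j) s) ∘ bind ρ k (var (toℕ k))
                ≗ bind (Maybe.map (subst (toℕ j) s) ∘ ρ) k (var (toℕ k))
        commute l with l ≟ k
        ... | yes _ = cong just (subst-var-≢ j≢k)
        ... | no  _ = refl

      subst-resolve : ∀ d ρ {j} s → ρ j ≢ nothing → ∀ l →
                      subst (toℕ j) s (resolve d ρ l) ≡ resolve d (Maybe.map (subst (toℕ j) s) ∘ ρ) l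
      subst-resolve d ρ s ρj≢nothing l with ρ l in ρl
      ... | just t  = refl
      ... | nothing = subst-bekić d ρ s ρj≢nothing ρl

    mutual
      freeIn-bekić : ∀ d ρ j → FreeIn x (bekić d ρ j) → Any (FreeIn x) ρ
      freeIn-bekić (suc d) ρ j (fμ x≢j h) with freeIn-equation j _ h
      ... | l , h′ with bind-any ρ j (var (toℕ j)) (freeIn-resolve d (bind ρ j (var (toℕ j))) l h′)
      ... | inj₁ x∈var = ⊥-elim (x≢j (freeIn-var x∈var))
      ... | inj₂ found = found

      freeIn-resolve : ∀ d ρ k → FreeIn x (resolve d ρ k) → Any (FreeIn x) ρ
      freeIn-resolve d ρ k h with ρ k in ρk
      ... | just t  = k , t , ρk , h
      ... | nothing = freeIn-bekić d ρ k h

    closed-polyTerm : ∀ {θ} → (∀ k → Closed (θ k)) → ∀ q → Closed (polyTerm θ q)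
    closed-polyTerm {θ} closed q x h with freeIn-polyTerm θ q h
    ... | k , h′ = closed k x h′

    closed-bekić : ∀ d ρ j → All (λ _ → Closed) ρ → Closed (bekić d ρ j)
    closed-bekić d ρ j closed x h with freeIn-bekić d ρ j h
    ... | l , t , e , h′ = closed l e x h′

    subst-bind-var : ∀ {ρ} → All (λ _ → Closed) ρ → ∀ d j s l →
                  subst (toℕ j) s (resolve d (bind ρ j (var (toℕ j))) l) ≡ resolve d (bind ρ j s) l
    subst-bind-var {ρ} closed d j s l =
      ≡.trans (subst-resolve d (bind ρ j (var (toℕ j))) s ρ′j≢nothing l) (resolve-cong d substituted l)
      where
      ρ′j≢nothing : bind ρ j (var (toℕ j)) j ≢ nothing
      ρ′j≢nothing e with ≡.trans (≡.sym (bind-same ρ j _)) e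
      ... | ()
      substituted : Maybe.map (subst (toℕ j) s) ∘ bind ρ j (var (toℕ j)) ≗ bind ρ j s
      substituted l with l ≟ j
      ... | yes _ = cong just subst-var-≡
      ... | no  _ with ρ l in ρl
      ...   | just t  = cong just (subst-fresh t (closed l ρl _))
      ...   | nothing = refl

module MuSemantics {c ℓ} (K : CommutativeSemiring c ℓ) (n : ℕ) where
  open CommutativeSemiring K hiding (zero)
    renaming (Carrier to R; refl to ≈-refl; sym to ≈-sym; trans to ≈-trans)
  open import Algebra.Properties.Semiring.Sum semiring
    using (sum; sum-remove; sum-cong-≋; sum-replicate-zero)
  open import Relation.Binary.Reasoning.Setoid setoid
  open Series K n
  open PowerSeriesAlgebra K n
  open MuSyntax K n hiding (module System)
  open PartialMaps {A = Term}

  sum-single : ∀ {k} (f : Fin k → R) i → (∀ j → j ≢ i → f j ≈ 0#) → sum f ≈ f i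
  sum-single {suc k} f i zero-elsewhere = begin
    sum f                     ≈⟨ sum-remove {i = i} f ⟩
    f i + sum (removeAt f i)  ≈⟨ +-congˡ (sum-cong-≋ λ j → zero-elsewhere _ (punchInᵢ≢i i j)) ⟩
    f i + sum {k} (λ _ → 0#)  ≈⟨ +-congˡ (sum-replicate-zero k) ⟩
    f i + 0#                  ≈⟨ +-identityʳ _ ⟩
    f i                       ∎

  0-sem : ⟦ const 0# ⟧μ ≈ₛ 0ₛ
  0-sem []      = ≈-refl
  0-sem (_ ∷ w) = 0-sem w

  const-sem : ∀ k → ⟦ const k ⟧μ ≈ₛ constant k
  const-sem k []      = ≈-refl
  const-sem k (_ ∷ w) = 0-sem w

  ⊕-sem : ∀ u v → ⟦ u ⊕ v ⟧μ ≈ₛ ⟦ u ⟧μ ⊞ ⟦ v ⟧μ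
  ⊕-sem u v []      = ≈-refl
  ⊕-sem u v (a ∷ w) = ⊕-sem (der u a) (der v a) w

  ⊗-sem : ∀ u v → ⟦ u ⊗ v ⟧μ ≈ₛ ⟦ u ⟧μ ⊙ ⟦ v ⟧μ
  ⊗-sem u v []      = ≈-refl
  ⊗-sem u v (a ∷ w) =
    ≈-trans (⊕-sem (der u a ⊗ v) (const (out u) ⊗ der v a) w)
            (+-cong (⊗-sem (der u a) v w)
                    (≈-trans (⊗-sem (const (out u)) (der v a) w)
                             (⊙-cong (const-sem (out u)) (λ _ → ≈-refl) w)))

  oG-gsum : ∀ {k} (f : Fin k → Guarded) → (∀ i → oG (f i) ≈ 0#) → oG (gsum f) ≈ 0#
  oG-gsum {zero}  f h = ≈-refl
  oG-gsum {suc k} f h = ≈-trans (+-cong (h zero) (oG-gsum (f ∘ suc) (h ∘ suc))) (+-identityˡ 0#)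

  derG-gsum : ∀ {k} (f : Fin k → Guarded) a w →
              ⟦ derG (gsum f) a ⟧μ w ≈ sum (λ i → ⟦ derG (f i) a ⟧μ w)
  derG-gsum {zero}  f a w = 0-sem w
  derG-gsum {suc k} f a w = ≈-trans (⊕-sem _ _ w) (+-congˡ (derG-gsum (f ∘ suc) a w))

  derG-gsym-≡ : ∀ a t → ⟦ derG (gsym a t) a ⟧μ ≈ₛ ⟦ t ⟧μ
  derG-gsym-≡ a t w with a ≟ a
  ... | no  a≢a = ⊥-elim (a≢a refl)
  ... | yes _   = begin
    ⟦ (const 1# ⊗ t) ⊕ (const 0# ⊗ t) ⟧μ w       ≈⟨ ⊕-sem _ _ w ⟩
    ⟦ const 1# ⊗ t ⟧μ w + ⟦ const 0# ⊗ t ⟧μ w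
      ≈⟨ +-cong (≈-trans (⊗-sem _ _ w) (≈-trans (⊙-cong (const-sem 1#) (λ _ → ≈-refl) w) (constant-⊙ w)))
                (≈-trans (⊗-sem _ _ w) (⊙-zeroˡ 0-sem w)) ⟩
    1# * ⟦ t ⟧μ w + 0#                            ≈⟨ +-identityʳ _ ⟩
    1# * ⟦ t ⟧μ w                                 ≈⟨ *-identityˡ _ ⟩
    ⟦ t ⟧μ w                                      ∎

  derG-gsym-≢ : ∀ {a b} t → a ≢ b → ⟦ derG (gsym b t) a ⟧μ ≈ₛ 0ₛ
  derG-gsym-≢ {a} {b} t a≢b w with a ≟ b
  ... | yes a≡b = ⊥-elim (a≢b a≡b)
  ... | no  _   = ≈-trans (⊕-sem _ _ w)
    (≈-trans (+-cong (≈-trans (⊗-sem _ _ w) (⊙-zeroˡ 0-sem w))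
                     (≈-trans (⊗-sem _ _ w) (⊙-zeroˡ 0-sem w)))
             (+-identityˡ 0#))

  derG-choice : ∀ (t : Alphabet → Term) a → ⟦ derG (gsum (λ b → gsym b (t b))) a ⟧μ ≈ₛ ⟦ t a ⟧μ
  derG-choice t a w = begin
    ⟦ derG (gsum (λ b → gsym b (t b))) a ⟧μ w      ≈⟨ derG-gsum _ a w ⟩
    sum (λ b → ⟦ derG (gsym b (t b)) a ⟧μ w)
      ≈⟨ sum-single _ a (λ b b≢a → derG-gsym-≢ (t b) (b≢a ∘ ≡.sym) w) ⟩
    ⟦ derG (gsym a (t a)) a ⟧μ w                   ≈⟨ derG-gsym-≡ a (t a) w ⟩
    ⟦ t a ⟧μ w                                     ∎

  module System {m : ℕ} (o : Fin m → R) (δ : Fin m → Alphabet → Polynomial m) where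
    open MuSyntax.System K n o δ

    monoTerm-sem : ∀ θ u → ⟦ monoTerm θ u ⟧μ ≈ₛ evalMono (⟦_⟧μ ∘ θ) u
    monoTerm-sem θ []        = const-sem 1#
    monoTerm-sem θ (x ∷ u) w = ≈-trans (⊗-sem _ _ w) (⊙-cong (λ _ → ≈-refl) (monoTerm-sem θ u) w)

    polyTerm-sem : ∀ θ q → ⟦ polyTerm θ q ⟧μ ≈ₛ evalPoly (⟦_⟧μ ∘ θ) q
    polyTerm-sem θ []              = 0-sem
    polyTerm-sem θ ((k , u) ∷ q) w = ≈-trans (⊕-sem _ _ w) (+-cong
      (≈-trans (⊗-sem _ _ w) (≈-trans (⊙-cong (const-sem k) (monoTerm-sem θ u) w) (constant-⊙ w)))
      (polyTerm-sem θ q w))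

    equation-output : ∀ j θ → oG (equation j θ) ≈ o j
    equation-output j θ =
      ≈-trans (+-congˡ (oG-gsum (λ b → gsym b (polyTerm θ (δ j b))) (λ _ → ≈-refl))) (+-identityʳ _)

    ∂-bekić : ∀ d {ρ} → All (λ _ → Closed) ρ → ∀ j a →
              ∂ ⟦ bekić (suc d) ρ j ⟧μ a
                ≈ₛ evalPoly (⟦_⟧μ ∘ resolve d (bind ρ j (bekić (suc d) ρ j))) (δ j a)
    ∂-bekić d {ρ} closed j a w = begin
      ⟦ derG (substG (toℕ j) self (equation j θ)) a ⟧μ w
        ≡⟨ cong (λ g → ⟦ derG g a ⟧μ w)
                (≡.trans (substG-equation j θ) (equation-cong j (subst-bind-var closed d j self))) ⟩
      ⟦ derG (equation j θ′) a ⟧μ w                  ≈⟨ ⊕-sem _ _ w ⟩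
      ⟦ const 0# ⟧μ w + ⟦ derG (gsum (λ b → gsym b (polyTerm θ′ (δ j b)))) a ⟧μ w
        ≈⟨ +-cong (0-sem w) (derG-choice (λ b → polyTerm θ′ (δ j b)) a w) ⟩
      0# + ⟦ polyTerm θ′ (δ j a) ⟧μ w                ≈⟨ +-identityˡ _ ⟩
      ⟦ polyTerm θ′ (δ j a) ⟧μ w                     ≈⟨ polyTerm-sem θ′ (δ j a) w ⟩
      evalPoly (⟦_⟧μ ∘ θ′) (δ j a) w                 ∎
      where
      self : Term
      self = bekić (suc d) ρ j
      θ θ′ : Fin m → Term
      θ  = resolve d (bind ρ j (var (toℕ j)))
      θ′ = resolve d (bind ρ j self)

    ∅ : Fin m → Maybe Term
    ∅ _ = nothing

    solutionTerm : Fin m → Term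
    solutionTerm = bekić (unbound ∅) ∅

    solutionTerm-closed : ∀ j → Closed (solutionTerm j)
    solutionTerm-closed j = closed-bekić (unbound ∅) ∅ j (λ _ ())

    solution : Fin m → PowerSeries
    solution = ⟦_⟧μ ∘ solutionTerm

    record Admissible (d : ℕ) (ρ : Fin m → Maybe Term) (j : Fin m) : Set c where
      field
        closed    : All (λ _ → Closed) ρ
        unbound-j : ρ j ≡ nothing
        depth     : unbound ρ ≤ d

    ∅-admissible : ∀ j → Admissible (unbound ∅) ∅ j
    ∅-admissible j = record { closed = λ _ (); unbound-j = refl; depth = ≤-refl }

    ¬admissible-zero : ∀ {ρ j} → ¬ Admissible zero ρ j
    ¬admissible-zero {ρ} {j} adm
      with unbound-bind-< {ρ = ρ} {j} (const 0#) (Admissible.unbound-j adm) (Admissible.depth adm)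
    ... | ()

    bekić-output : ∀ {d ρ j} → Admissible d ρ j → ⟦ bekić d ρ j ⟧μ [] ≈ o j
    bekić-output {zero}  adm = ⊥-elim (¬admissible-zero adm)
    bekić-output {suc d} {ρ} {j} adm = equation-output j (resolve d (bind ρ j (var (toℕ j))))

    Agrees : ℕ → Fin m → Term → Set ℓ
    Agrees N k t = ⟦ t ⟧μ ≈[ N ] solution k

    BekićAgrees : ℕ → Set (c ⊔ ℓ)
    BekićAgrees N = ∀ {d ρ j} → Admissible d ρ j → All (Agrees N) ρ → Agrees N j (bekić d ρ j)

    resolve-agrees : ∀ {N} → BekićAgrees N → ∀ {d ρ} → All (λ _ → Closed) ρ → All (Agrees N) ρ →
                     unbound ρ ≤ d → ∀ k → Agrees N k (resolve d ρ k)
    resolve-agrees IH {ρ = ρ} closed agree depth k with ρ k in ρk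
    ... | just t  = agree k ρk
    ... | nothing = IH (record { closed = closed; unbound-j = ρk; depth = depth }) agree

    ∂-bekić-≈[] : ∀ {N} → BekićAgrees N → ∀ {d ρ j} → Admissible d ρ j → All (Agrees (suc N)) ρ →
                  ∀ a → ∂ ⟦ bekić d ρ j ⟧μ a ≈[ N ] evalPoly solution (δ j a)
    ∂-bekić-≈[] IH {zero}  adm = ⊥-elim (¬admissible-zero adm)
    ∂-bekić-≈[] IH {suc d} {ρ} {j} adm agree a w l =
      ≈-trans (∂-bekić d closed j a w)
              (evalPoly-cong-≈[] (resolve-agrees IH {ρ = bind ρ j self} closed′ agree′ depth′) (δ j a) w l)
      where
      open Admissible adm
      agreeN : All (Agrees _) ρ
      agreeN k e = ≈[]-pred (agree k e)
      self : Term
      self = bekić (suc d) ρ j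
      closed′ : All (λ _ → Closed) (bind ρ j self)
      closed′ = bind-all ρ j self closed (closed-bekić (suc d) ρ j closed)
      agree′ : All (Agrees _) (bind ρ j self)
      agree′ = bind-all ρ j self agreeN (IH adm agreeN)
      depth′ : unbound (bind ρ j self) ≤ d
      depth′ = s≤s⁻¹ (unbound-bind-< {ρ = ρ} self unbound-j depth)

    bekić-agrees : ∀ N → BekićAgrees N
    bekić-agrees N       adm agree []      _       =
      ≈-trans (bekić-output adm) (≈-sym (bekić-output (∅-admissible _)))
    bekić-agrees (suc N) adm agree (a ∷ w) (s≤s l) =
      ≈-trans (∂-bekić-≈[] (bekić-agrees N) adm agree a w l)
              (≈-sym (∂-bekić-≈[] (bekić-agrees N) (∅-admissible _) (λ _ ()) a w l))

    solution-isSolution : IsSolution o δ solution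
    solution-isSolution = record
      { output     = bekić-output ∘ ∅-admissible
      ; derivative = λ j a w → ∂-bekić-≈[] (bekić-agrees (length w)) (∅-admissible j) (λ _ ()) a w ≤-refl
      }

theorem6p9 : ∀ {c ℓ} (K : CommutativeSemiring c ℓ) (n : ℕ)
               (σ : Series.PowerSeries K n) → Series.ContextFree K n σ →
               Σ[ t ∈ Series.Term K n ]
                 (Series.Closed K n t × Series._≈ₛ_ K n (Series.⟦_⟧μ K n t) σ)
theorem6p9 K n σ (m , o , δ , p , ⟦p⟧≈σ) =
  polyTerm solutionTerm p , closed-polyTerm solutionTerm-closed p , λ w → begin
    ⟦ polyTerm solutionTerm p ⟧μ w  ≈⟨ polyTerm-sem solutionTerm p w ⟩
    evalPoly solution p w           ≈⟨ ⟦⟧≈evalPoly o δ solution-isSolution p w ⟨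
    Extension.⟦_⟧ o δ p w           ≈⟨ ⟦p⟧≈σ w ⟩
    σ w                             ∎
  where
  open CommutativeSemiring K using (setoid)
  open import Relation.Binary.Reasoning.Setoid setoid
  open Series K n
  open PowerSeriesAlgebra K n using (evalPoly; ⟦⟧≈evalPoly)
  open MuSyntax.System K n o δ using (polyTerm; closed-polyTerm)
  open MuSemantics.System K n o δ
    using (solutionTerm; solutionTerm-closed; solution; solution-isSolution; polyTerm-sem)
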